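{- For all integers $m,n\ge 1$, the number $T_{m,n}$ of spotlight tilings of an $m\times n$ rectangle satisfies $$T_{m,n}=\binom{m+n}{m}-\binom{m+n-2}{m-1}.$$
   Context: A region is a finite set of unit squares of the square grid whose edge-adjacency graph is connected. A northwest corner of a region $R$ is a square of $R$ such that neither the square directly above it (north) nor the square directly to its left (west) belongs to $R$. A spotlight tiling of $R$ is produced recursively: choose a northwest corner $s$ of $R$ and place a spotlight with endpoint $s$, extending either east (horizontally) or south (vertically) as far as possible, i.e. consisting of $s$ together with the maximal run of consecutive squares of $R$ in that direction. The squares of $R$ not covered by this spotlight form a disjoint union of regions (connected components), and each component is then given a spotlight tiling recursively; the empty region has exactly one (empty) tiling. The resulting spotlight tiling is the final collection of spotlights, a partition of $R$ into horizontal and vertical segments. Two spotlight tilings are considered the same if and only if they give the same collection of spotlights, regardless of the order of placement; in particular, a last-placed spotlight of length $1$ is not assigned a direction. $T_{m,n}$ denotes the number of spotlight tilings of the $m\times n$ rectangle ($m$ rows, $n$ columns). -}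

module Defs where

open import Level using (0ℓ)
open import Data.Nat using (ℕ; zero; suc; _+_; _<_; _≤_)
open import Data.Product using (Σ; ∃; ∃-syntax; _×_; _,_)
open import Data.List using (List; []; _∷_; concat; length)
open import Data.List.Relation.Unary.All using (All)
open import Data.List.Relation.Unary.Any using (Any)
open import Data.List.Relation.Unary.AllPairs using (AllPairs)
open import Data.List.Relation.Binary.Pointwise using (Pointwise)
open import Data.List.Membership.Propositional using (_∈_)
open import Relation.Binary.PropositionalEquality using (_≡_)
open import Relation.Nullary using (¬_)
open import Relation.Unary using (Pred)
open import Function.Bundles using (_⇔_)

-- A square of the grid: (row , column).  Rows increase southwards,
-- columns increase eastwards.  We use ℕ × ℕ; every region considered is
-- contained in a rectangle placed at the origin.
Cell : Set
Cell = ℕ × ℕ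

Region : Set₁
Region = Pred Cell 0ℓ

data Adj : Cell → Cell → Set where
  east  : ∀ r c → Adj (r , c) (r , suc c)
  west  : ∀ r c → Adj (r , suc c) (r , c)
  south : ∀ r c → Adj (r , c) (suc r , c)
  north : ∀ r c → Adj (suc r , c) (r , c)

data Path (R : Region) : Cell → Cell → Set where
  here : ∀ {a} → R a → Path R a a
  step : ∀ {a b c} → R a → Adj a b → Path R b c → Path R a c

Connected : Region → Set
Connected R = ∀ a b → R a → R b → Path R a b

NWCorner : Region → Cell → Set
NWCorner R (r , c) =
  R (r , c)
  × (∀ r' → r ≡ suc r' → ¬ R (r' , c))
  × (∀ c' → c ≡ suc c' → ¬ R (r , c'))

data Dir : Set where
  horizontal vertical : Dir

shift : Dir → Cell → ℕ → Cell
shift horizontal (r , c) i = (r , c + i)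
shift vertical   (r , c) i = (r + i , c)

record Spot : Set where
  constructor spot
  field
    endpoint : Cell
    dir      : Dir
    len      : ℕ
open Spot public

SpotCells : Spot → Region
SpotCells σ x = ∃[ i ] (i < len σ × x ≡ shift (dir σ) (endpoint σ) i)

MaximalIn : Region → Spot → Set
MaximalIn R σ =
  1 ≤ len σ
  × (∀ i → i < len σ → R (shift (dir σ) (endpoint σ) i))
  × ¬ R (shift (dir σ) (endpoint σ) (len σ))

_minus_ : Region → Spot → Region
(R minus σ) x = R x × ¬ SpotCells σ x

Components : Region → List Region → Set₁
Components R Cs =
  All (λ C → (∃[ x ] C x) × Connected C × (∀ x → C x → R x)) Cs
  × (∀ x → R x → Any (λ C → C x) Cs)
  × AllPairs (λ C D → (∀ x → C x → ¬ D x)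
                    × (∀ x y → C x → D y → ¬ Adj x y)) Cs

-- Tiles R S : S (a list of spotlights) is a spotlight tiling of R,
-- produced by the recursive procedure: place a spotlight at a northwest
-- corner, maximal in one direction, then tile each connected component
-- of the remaining squares recursively.
data Tiles (R : Region) : List Spot → Set₁ where
  empty : (∀ x → ¬ R x) → Tiles R []
  place : (σ : Spot) → NWCorner R (endpoint σ) → MaximalIn R σ →
          (Cs : List Region) → Components (R minus σ) Cs →
          (Ss : List (List Spot)) → Pointwise Tiles Cs Ss →
          Tiles R (σ ∷ concat Ss)

-- Two spotlights are the same if they consist of the same squares
-- (so a spotlight of length 1 carries no direction).
SameSpot : Spot → Spot → Set
SameSpot σ τ = ∀ x → SpotCells σ x ⇔ SpotCells τ x

SameTiling : List Spot → List Spot → Set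
SameTiling A B =
  (∀ σ → σ ∈ A → Any (SameSpot σ) B) × (∀ τ → τ ∈ B → Any (SameSpot τ) A)

Rect : ℕ → ℕ → Region
Rect m n (r , c) = r < m × c < n

-- "T_{m,n} = k": there is a list of exactly k spotlight tilings of the
-- m × n rectangle, pairwise distinct as collections of spotlights, such
-- that every spotlight tiling equals one of them.
NumTilingsIs : ℕ → ℕ → ℕ → Set₁
NumTilingsIs m n k =
  Σ (List (List Spot)) λ L →
    length L ≡ k
    × All (Tiles (Rect m n)) L
    × AllPairs (λ A B → ¬ SameTiling A B) L
    × (∀ S → Tiles (Rect m n) S → Any (SameTiling S) L)

module Submission where

open import Defs
open import Data.Nat using (ℕ; zero; suc; _+_; _∸_; _≤_; _<_; z≤n; s≤s)
open import Data.Nat.Properties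
open import Data.Nat.Combinatorics using (_C_; nCn≡1)
  renaming (nCk+nC[k+1]≡[n+1]C[k+1] to pascal)
open import Algebra.Properties.CommutativeSemigroup +-commutativeSemigroup using (interchange)
open import Data.Product using (∃-syntax; _×_; _,_; proj₁; proj₂)
open import Data.Sum using (_⊎_; inj₁; inj₂)
open import Data.List using (List; []; _∷_; _++_; map; concat; length)
open import Data.List.Properties using (length-++; length-map; ++-identityʳ)
open import Data.List.Relation.Unary.All as All using (All; []; _∷_)
import Data.List.Relation.Unary.All.Properties as AllP
open import Data.List.Relation.Unary.Any as Any using (Any; here; there)
import Data.List.Relation.Unary.Any.Properties as AnyP
open import Data.List.Relation.Unary.AllPairs using (AllPairs; []; _∷_)
import Data.List.Relation.Unary.AllPairs.Properties as AllPairsP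
open import Data.List.Relation.Binary.Pointwise using (Pointwise; []; _∷_)
open import Data.List.Membership.Propositional using (_∈_)
open import Data.List.Membership.Propositional.Properties using (∈-++⁻)
open import Data.Empty using (⊥-elim)
open import Relation.Nullary using (¬_)
open import Relation.Unary using (_⊆_; _≐_)
open import Relation.Unary.Properties using (≐-sym; ≐-trans)
open import Relation.Binary.Definitions using (tri<; tri≈; tri>)
open import Relation.Binary.PropositionalEquality
  using (_≡_; refl; sym; trans; cong; cong₂; subst; module ≡-Reasoning)
open import Function.Bundles using (mk⇔; Equivalence)

-- A rectangle (a "box") has exactly one northwest corner, its
-- top-left square, and a maximal spotlight from it is either the whole top
-- row or the whole left column.  Removing it leaves a smaller box, which is
-- connected, hence a single component (or nothing).  So a tiling of an
-- m × n box is its top row followed by a tiling of the (m-1) × n box below,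
-- or its left column followed by a tiling of the m × (n-1) box to the
-- right; the only coincidence is the 1 × 1 box, where row and column are
-- the same spotlight.  Its length satisfies Pascal's recurrence
-- except at the 1 × 1 box; the deficit is the number of lattice paths
-- through that box, which gives T(m,n) = C(m+n,m) - C(m+n-2,m-1).

Box : ℕ → ℕ → ℕ → ℕ → Region
Box a b m n (r , c) = a ≤ r × r < m + a × b ≤ c × c < n + b

rowSpot : ℕ → ℕ → ℕ → Spot
rowSpot a b n = spot (a , b) horizontal n

colSpot : ℕ → ℕ → ℕ → Spot
colSpot a b m = spot (a , b) vertical m

offset< : ∀ {b c n} → b ≤ c → c < n + b → c ∸ b < n
offset< {b} {c} {n} b≤c c< = +-cancelʳ-< b (c ∸ b) n (subst (_< n + b) (sym (m∸n+n≡m b≤c)) c<)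

shifted< : ∀ {b i n} → i < n → b + i < n + b
shifted< {b} {i} {n} i<n = subst (_< n + b) (+-comm i b) (+-monoˡ-< b i<n)

box-offset : ∀ {a b m n} i j → i < m → j < n → Box a b m n (i + a , j + b)
box-offset {a} {b} i j i<m j<n = m≤n+m a i , +-monoˡ-< a i<m , m≤n+m b j , +-monoˡ-< b j<n

box-corner : ∀ {a b m n} → Box a b (suc m) (suc n) (a , b)
box-corner = box-offset 0 0 (s≤s z≤n) (s≤s z≤n)

box-no-rows : ∀ {a b n} x → ¬ Box a b 0 n x
box-no-rows (r , c) (a≤r , r<a , _) = n≮n r (≤-trans r<a a≤r)

box-no-cols : ∀ {a b m} x → ¬ Box a b m 0 x
box-no-cols (r , c) (_ , _ , b≤c , c<b) = n≮n c (≤-trans c<b b≤c)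

rect≐box : ∀ m n → Rect m n ≐ Box 0 0 m n
rect≐box m n = to , from
  where
  to : Rect m n ⊆ Box 0 0 m n
  to {r , c} (r< , c<) = z≤n , subst (r <_) (sym (+-identityʳ m)) r< , z≤n , subst (c <_) (sym (+-identityʳ n)) c<
  from : Box 0 0 m n ⊆ Rect m n
  from {r , c} (_ , r< , _ , c<) = subst (r <_) (+-identityʳ m) r< , subst (c <_) (+-identityʳ n) c<

adj-sym : ∀ {x y} → Adj x y → Adj y x
adj-sym (east r c)  = west r c
adj-sym (west r c)  = east r c
adj-sym (south r c) = north r c
adj-sym (north r c) = south r c

path-start : ∀ {R x y} → Path R x y → R x
path-start (here r)     = r
path-start (step r _ _) = r

_++ᵖ_ : ∀ {R x y z} → Path R x y → Path R y z → Path R x z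
here _       ++ᵖ q = q
step r ad p  ++ᵖ q = step r ad (p ++ᵖ q)

reverse-path : ∀ {R x y} → Path R x y → Path R y x
reverse-path (here r)      = here r
reverse-path (step r ad p) = reverse-path p ++ᵖ step (path-start p) (adj-sym ad) (here r)

path-to-corner : ∀ {a b m n} i j → i < m → j < n →
                 Path (Box a b m n) (i + a , j + b) (a , b)
path-to-corner zero zero i<m j<n = here (box-offset 0 0 i<m j<n)
path-to-corner {a} {b} zero (suc j) i<m j<n =
  step (box-offset 0 (suc j) i<m j<n) (west a (j + b)) (path-to-corner 0 j i<m (<-trans (n<1+n j) j<n))
path-to-corner {a} {b} (suc i) j i<m j<n =
  step (box-offset (suc i) j i<m j<n) (north (i + a) (j + b)) (path-to-corner i j (<-trans (n<1+n i) i<m) j<n)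

box-connected : ∀ a b m n → Connected (Box a b m n)
box-connected a b m n x y bx by = to-corner x bx ++ᵖ reverse-path (to-corner y by)
  where
  to-corner : ∀ x → Box a b m n x → Path (Box a b m n) x (a , b)
  to-corner (r , c) (a≤r , r< , b≤c , c<) =
    subst (λ z → Path (Box a b m n) z (a , b)) (cong₂ _,_ (m∸n+n≡m a≤r) (m∸n+n≡m b≤c))
          (path-to-corner (r ∸ a) (c ∸ b) (offset< a≤r r<) (offset< b≤c c<))

components-of-empty : ∀ {R} → (∀ x → ¬ R x) → Components R []
components-of-empty ne = [] , (λ x rx → ⊥-elim (ne x rx)) , []

components-of-connected : ∀ {R K} → (∃[ x ] K x) → Connected K → R ≐ K → Components R (K ∷ [])
components-of-connected nonempty conn (to , from) =
  (nonempty , conn , λ _ → from) ∷ [] , (λ _ rx → here (to rx)) , [] ∷ []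

no-components⇒empty : ∀ {R x} → Components R [] → ¬ R x
no-components⇒empty {x = x} (_ , cover , _) rx with cover x rx
... | ()

single-component : ∀ {R K} → Components R (K ∷ []) → K ≐ R
single-component {R} {K} ((_ , _ , K⊆R) ∷ [] , cover , _) = K⊆R _ , R⊆K
  where
  R⊆K : R ⊆ K
  R⊆K {x} rx with cover x rx
  ... | here kx = kx

-- Walking along a path of B from a square of the second component, every
-- step stays among the later components, since the first one is disjoint
-- from and not adjacent to them; so the path never reaches the first one.
connected⇒one-component : ∀ {R B K D Ds} → Connected B → R ≐ B → ¬ Components R (K ∷ D ∷ Ds)
connected⇒one-component {R} {B} {K} {D} {Ds} conn (to , from)
  (((x , kx) , _ , K⊆R) ∷ ((y , dy) , _ , D⊆R) ∷ _ , cover , (K-apart ∷ _)) =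
  All.lookupWith (λ apart ex → proj₁ apart x kx ex) K-apart
    (walk (conn y x (to (D⊆R y dy)) (to (K⊆R x kx))) (here dy))
  where
  walk : ∀ {z w} → Path B z w → Any (λ E → E z) (D ∷ Ds) → Any (λ E → E w) (D ∷ Ds)
  walk (here _) later = later
  walk {z} (step _ ad p) later with cover _ (from (path-start p))
  ... | here kz' = ⊥-elim (All.lookupWith (λ apart ez → proj₂ apart _ z kz' ez (adj-sym ad)) K-apart later)
  ... | there later' = walk p later'

minus-resp-≐ : ∀ {R R' σ} → R ≐ R' → (R minus σ) ≐ (R' minus σ)
minus-resp-≐ (to , from) = (λ (rx , out) → to rx , out) , (λ (rx , out) → from rx , out)

components-resp-≐ : ∀ {R R' Cs} → R ≐ R' → Components R Cs → Components R' Cs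
components-resp-≐ (to , from) (valid , cover , apart) =
  All.map (λ (ne , conn , K⊆R) → ne , conn , λ x kx → to (K⊆R x kx)) valid
  , (λ x rx → cover x (from rx)) , apart

tiles-resp-≐ : ∀ {R R' S} → R ≐ R' → Tiles R S → Tiles R' S
tiles-resp-≐ (to , from) (empty ne) = empty (λ x rx → ne x (from rx))
tiles-resp-≐ e@(to , from) (place σ@(spot (r , c) _ _) (rc , no-north , no-west) (l1 , inside , stop) Cs comps Ss tiles) =
  place σ (to rc , (λ r' eq rx → no-north r' eq (from rx)) , (λ c' eq rx → no-west c' eq (from rx)))
        (l1 , (λ i i<l → to (inside i i<l)) , (λ rx → stop (from rx)))
        Cs (components-resp-≐ (minus-resp-≐ e) comps) Ss tiles

tiles-of-empty : ∀ {R S} → (∀ x → ¬ R x) → Tiles R S → S ≡ []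
tiles-of-empty ne (empty _) = refl
tiles-of-empty ne (place (spot s _ _) (rs , _) _ _ _ _ _) = ⊥-elim (ne s rs)

extend-tiling : ∀ {R K σ A} → NWCorner R (endpoint σ) → MaximalIn R σ → Connected K →
                (R minus σ) ≐ K → Tiles K A → Tiles R (σ ∷ A)
extend-tiling nw max conn rest (empty ne) =
  place _ nw max [] (components-of-empty (λ x rx → ne x (proj₁ rest rx))) [] []
extend-tiling {R} {K} {σ} {A} nw max conn rest t@(place (spot s _ _) (ks , _) _ _ _ _ _) =
  subst (λ S → Tiles R (σ ∷ S)) (++-identityʳ A)
        (place σ nw max (K ∷ []) (components-of-connected (s , ks) conn rest) (A ∷ []) (t ∷ []))

remainder-tiling : ∀ {R K Cs Ss} → Connected K → R ≐ K → Components R Cs →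
                   Pointwise Tiles Cs Ss → Tiles K (concat Ss)
remainder-tiling conn e comps [] = empty (λ x kx → no-components⇒empty comps (proj₂ e kx))
remainder-tiling {K = K} conn e comps (_∷_ {y = A} t []) =
  subst (Tiles K) (sym (++-identityʳ A)) (tiles-resp-≐ (≐-trans (single-component comps) e) t)
remainder-tiling conn e comps (_ ∷ _ ∷ _) = ⊥-elim (connected⇒one-component conn e comps)

mutual
  spots-inside : ∀ {R S τ} → Tiles R S → τ ∈ S → SpotCells τ ⊆ R
  spots-inside (empty _) ()
  spots-inside (place σ _ (_ , inside , _) _ _ _ _) (here refl) (i , i<l , refl) = inside i i<l
  spots-inside (place σ _ _ _ (valid , _ , _) _ tiles) (there τ∈) x∈τ =
    proj₁ (components-spots-inside valid tiles τ∈ x∈τ)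

  components-spots-inside : ∀ {R Cs Ss τ} → All (λ K → (∃[ x ] K x) × Connected K × (∀ x → K x → R x)) Cs →
                            Pointwise Tiles Cs Ss → τ ∈ concat Ss → SpotCells τ ⊆ R
  components-spots-inside ((_ , _ , K⊆R) ∷ valid) (_∷_ {y = A} t tiles) τ∈ x∈τ with ∈-++⁻ A τ∈
  ... | inj₁ τ∈A = K⊆R _ (spots-inside t τ∈A x∈τ)
  ... | inj₂ τ∈rest = components-spots-inside valid tiles τ∈rest x∈τ

first-index : ∀ {a r} → a ≤ r → (∀ r' → r ≡ suc r' → ¬ a ≤ r') → r ≡ a
first-index a≤r not-before with m≤n⇒m<n∨m≡n a≤r
... | inj₂ eq      = sym eq
... | inj₁ (s≤s p) = ⊥-elim (not-before _ refl p)

box-nw-corner : ∀ {a b m n r c} → NWCorner (Box a b m n) (r , c) → r ≡ a × c ≡ b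
box-nw-corner ((a≤r , r< , b≤c , c<) , no-north , no-west) =
  first-index a≤r (λ r' eq p → no-north r' eq (p , <-trans (n<1+n r') (subst (_< _) eq r<) , b≤c , c<))
  , first-index b≤c (λ c' eq p → no-west c' eq (a≤r , r< , p , <-trans (n<1+n c') (subst (_< _) eq c<)))

corner-is-nw : ∀ {a b m n} → NWCorner (Box a b (suc m) (suc n)) (a , b)
corner-is-nw = box-corner , (λ r' eq (a≤r' , _) → n≮n r' (subst (_≤ r') eq a≤r'))
                          , (λ c' eq (_ , _ , b≤c' , _) → n≮n c' (subst (_≤ c') eq b≤c'))

row-cell : ∀ {a b m n i} → i < n → Box a b (suc m) n (a , b + i)
row-cell {a} {b} {m} {n} {i} i<n = ≤-refl , s≤s (m≤n+m a m) , m≤m+n b i , shifted< i<n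

col-cell : ∀ {a b m n i} → i < m → Box a b m (suc n) (a + i , b)
col-cell {a} {b} {m} {n} {i} i<m = m≤m+n a i , shifted< i<m , ≤-refl , s≤s (m≤n+m b n)

row-maximal : ∀ {a b m n} → MaximalIn (Box a b (suc m) (suc n)) (rowSpot a b (suc n))
row-maximal {b = b} {n = n} =
  s≤s z≤n , (λ i → row-cell {i = i}) , λ (_ , _ , _ , c<) → n≮n _ (subst (_< suc n + b) (+-comm b (suc n)) c<)

col-maximal : ∀ {a b m n} → MaximalIn (Box a b (suc m) (suc n)) (colSpot a b (suc m))
col-maximal {a = a} {m = m} =
  s≤s z≤n , (λ i → col-cell {i = i}) , λ (_ , r< , _ , _) → n≮n _ (subst (_< suc m + a) (+-comm a (suc m)) r<)

-- Conversely, a maximal spotlight at the corner has the length of the box's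
-- row (or column): shorter ones could be extended, longer ones leave the box.
maximal-row-length : ∀ {a b m n l} → MaximalIn (Box a b (suc m) n) (rowSpot a b l) → l ≡ n
maximal-row-length {b = b} {n = n} {l} (_ , inside , stop) with <-cmp l n
... | tri≈ _ l≡n _ = l≡n
... | tri< l<n _ _ = ⊥-elim (stop (row-cell l<n))
... | tri> _ _ n<l = ⊥-elim (n≮n _ (subst (_< n + b) (+-comm b n) (proj₂ (proj₂ (proj₂ (inside n n<l))))))

maximal-col-length : ∀ {a b m n l} → MaximalIn (Box a b m (suc n)) (colSpot a b l) → l ≡ m
maximal-col-length {a = a} {m = m} {l = l} (_ , inside , stop) with <-cmp l m
... | tri≈ _ l≡m _ = l≡m
... | tri< l<m _ _ = ⊥-elim (stop (col-cell l<m))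
... | tri> _ _ m<l = ⊥-elim (n≮n _ (subst (_< m + a) (+-comm a m) (proj₁ (proj₂ (inside m m<l)))))

first-spot : ∀ {a b m n σ} → NWCorner (Box a b (suc m) (suc n)) (endpoint σ) →
             MaximalIn (Box a b (suc m) (suc n)) σ →
             σ ≡ rowSpot a b (suc n) ⊎ σ ≡ colSpot a b (suc m)
first-spot {σ = spot (r , c) horizontal l} nw max with box-nw-corner nw
... | refl , refl = inj₁ (cong (rowSpot r c) (maximal-row-length max))
first-spot {σ = spot (r , c) vertical l} nw max with box-nw-corner nw
... | refl , refl = inj₂ (cong (colSpot r c) (maximal-col-length max))

row-remainder : ∀ {a b m n} → (Box a b (suc m) n minus rowSpot a b n) ≐ Box (suc a) b m n
row-remainder {a} {b} {m} {n} = to , from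
  where
  to : (Box a b (suc m) n minus rowSpot a b n) ⊆ Box (suc a) b m n
  to {r , c} ((a≤r , r< , b≤c , c<) , off-row) with m≤n⇒m<n∨m≡n a≤r
  ... | inj₁ a<r  = a<r , subst (r <_) (sym (+-suc m a)) r< , b≤c , c<
  ... | inj₂ refl = ⊥-elim (off-row (c ∸ b , offset< b≤c c< , cong (r ,_) (sym (m+[n∸m]≡n b≤c))))
  from : Box (suc a) b m n ⊆ (Box a b (suc m) n minus rowSpot a b n)
  from {r , c} (a<r , r< , b≤c , c<) =
    (<⇒≤ a<r , subst (r <_) (+-suc m a) r< , b≤c , c<) , λ (_ , _ , eq) → n≮n r (subst (_< r) (sym (cong proj₁ eq)) a<r)

col-remainder : ∀ {a b m n} → (Box a b m (suc n) minus colSpot a b m) ≐ Box a (suc b) m n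
col-remainder {a} {b} {m} {n} = to , from
  where
  to : (Box a b m (suc n) minus colSpot a b m) ⊆ Box a (suc b) m n
  to {r , c} ((a≤r , r< , b≤c , c<) , off-col) with m≤n⇒m<n∨m≡n b≤c
  ... | inj₁ b<c  = a≤r , r< , b<c , subst (c <_) (sym (+-suc n b)) c<
  ... | inj₂ refl = ⊥-elim (off-col (r ∸ a , offset< a≤r r< , cong (_, c) (sym (m+[n∸m]≡n a≤r))))
  from : Box a (suc b) m n ⊆ (Box a b m (suc n) minus colSpot a b m)
  from {r , c} (a≤r , r< , b<c , c<) =
    (a≤r , r< , <⇒≤ b<c , subst (c <_) (+-suc n b) c<) , λ (_ , _ , eq) → n≮n c (subst (_< c) (sym (cong proj₂ eq)) b<c)

-- A tiling of a nonempty box is its top row followed by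
-- a tiling of the box below, or its left column followed by a tiling of
-- the box to the right; 'columnTails' omits the latter in the 1 × 1 box,
-- where the column is the row already listed.
mutual
  boxTilings : ℕ → ℕ → ℕ → ℕ → List (List Spot)
  boxTilings a b zero    n       = [] ∷ []
  boxTilings a b (suc m) zero    = [] ∷ []
  boxTilings a b (suc m) (suc n) =
    map (rowSpot a b (suc n) ∷_) (boxTilings (suc a) b m (suc n))
    ++ map (colSpot a b (suc m) ∷_) (columnTails a b (suc m) n)

  columnTails : ℕ → ℕ → ℕ → ℕ → List (List Spot)
  columnTails a b (suc zero) zero = []
  columnTails a b m          n    = boxTilings a (suc b) m n

mutual
  sound : ∀ a b m n → All (Tiles (Box a b m n)) (boxTilings a b m n)
  sound a b zero    n       = empty box-no-rows ∷ []
  sound a b (suc m) zero    = empty box-no-cols ∷ []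
  sound a b (suc m) (suc n) = AllP.++⁺
    (AllP.map⁺ (All.map (extend-tiling corner-is-nw row-maximal (box-connected _ _ _ _) row-remainder)
                        (sound (suc a) b m (suc n))))
    (AllP.map⁺ (All.map (extend-tiling corner-is-nw col-maximal (box-connected _ _ _ _) col-remainder)
                        (sound-columnTails a b m n)))

  sound-columnTails : ∀ a b m n → All (Tiles (Box a (suc b) (suc m) n)) (columnTails a b (suc m) n)
  sound-columnTails a b zero    zero    = []
  sound-columnTails a b zero    (suc n) = sound a (suc b) 1 (suc n)
  sound-columnTails a b (suc m) n       = sound a (suc b) (suc (suc m)) n

-- Two tilings starting with the same spotlight σ are the
-- same only if their tails are, provided the tails avoid a square of σ;
-- tilings starting with different spotlights at the corner differ.
Distinct : List Spot → List Spot → Set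
Distinct A B = ¬ SameTiling A B

Avoids : Cell → List Spot → Set
Avoids x A = All (λ τ → ¬ SpotCells τ x) A

corner-on-row : ∀ {a b n} → SpotCells (rowSpot a b (suc n)) (a , b)
corner-on-row {a} {b} = 0 , s≤s z≤n , cong (a ,_) (sym (+-identityʳ b))

corner-on-col : ∀ {a b m} → SpotCells (colSpot a b (suc m)) (a , b)
corner-on-col {a} {b} = 0 , s≤s z≤n , cong (_, b) (sym (+-identityʳ a))

-- Cancelling a common first spotlight σ, when neither tail covers a given
-- square of σ (so σ can only be matched by σ itself).
same-tiling-cancel : ∀ {σ A B x} → SpotCells σ x → Avoids x A → Avoids x B →
                     SameTiling (σ ∷ A) (σ ∷ B) → SameTiling A B
same-tiling-cancel {σ} {A} {B} {x} x∈σ avoidA avoidB (A⊑B , B⊑A) = drop avoidA A⊑B , drop avoidB B⊑A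
  where
  drop : ∀ {X Y} → Avoids x X → (∀ τ → τ ∈ σ ∷ X → Any (SameSpot τ) (σ ∷ Y)) → ∀ τ → τ ∈ X → Any (SameSpot τ) Y
  drop avoid matched τ τ∈X with matched τ (there τ∈X)
  ... | here same   = ⊥-elim (All.lookup avoid τ∈X (Equivalence.from (same x) x∈σ))
  ... | there found = found

-- Different first spotlights: σ must be matched by σ', since B avoids σ.
distinct-heads : ∀ {σ σ' A B x} → ¬ SameSpot σ σ' → SpotCells σ x → Avoids x B →
                 Distinct (σ ∷ A) (σ' ∷ B)
distinct-heads {σ} different x∈σ avoidB (A⊑B , _) with A⊑B σ (here refl)
... | here same   = different same
... | there found = All.lookupWith (λ avoids same → avoids (Equivalence.to (same _) x∈σ)) avoidB found

long-row≉col : ∀ {a b n k} → ¬ SameSpot (rowSpot a b (suc (suc n))) (colSpot a b k)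
long-row≉col {a} {b} same with Equivalence.to (same (a , b + 1)) (1 , s≤s (s≤s z≤n) , refl)
... | _ , _ , eq = m+1+n≢m b (cong proj₂ eq)

row≉long-col : ∀ {a b m k} → ¬ SameSpot (rowSpot a b k) (colSpot a b (suc (suc m)))
row≉long-col {a} {b} same with Equivalence.from (same (a + 1 , b)) (1 , s≤s (s≤s z≤n) , refl)
... | _ , _ , eq = m+1+n≢m a (cong proj₁ eq)

cons-distinct : ∀ {σ x L} → SpotCells σ x → All (Avoids x) L → AllPairs Distinct L →
                AllPairs Distinct (map (σ ∷_) L)
cons-distinct x∈σ [] [] = []
cons-distinct x∈σ (avoidA ∷ avoids) (distinctA ∷ distincts) =
  AllP.map⁺ (All.zipWith (λ (avoidB , d) same → d (same-tiling-cancel x∈σ avoidA avoidB same))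
                         (avoids , distinctA))
  ∷ cons-distinct x∈σ avoids distincts

below-avoids-corner : ∀ a b m n → All (Avoids (a , b)) (boxTilings (suc a) b m n)
below-avoids-corner a b m n =
  All.map (λ t → All.tabulate (λ τ∈ x∈τ → n≮n a (proj₁ (spots-inside t τ∈ x∈τ))))
          (sound (suc a) b m n)

right-avoids-corner : ∀ a b m n → All (Avoids (a , b)) (columnTails a b (suc m) n)
right-avoids-corner a b m n =
  All.map (λ t → All.tabulate (λ τ∈ x∈τ → n≮n b (proj₁ (proj₂ (proj₂ (spots-inside t τ∈ x∈τ))))))
          (sound-columnTails a b m n)

mutual
  distinct : ∀ a b m n → AllPairs Distinct (boxTilings a b m n)
  distinct a b zero    n       = [] ∷ []
  distinct a b (suc m) zero    = [] ∷ []
  distinct a b (suc m) (suc n) = AllPairsP.++⁺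
    (cons-distinct corner-on-row (below-avoids-corner a b m (suc n)) (distinct (suc a) b m (suc n)))
    (cons-distinct corner-on-col (right-avoids-corner a b m n) (distinct-columnTails a b m n))
    (AllP.map⁺ (All.universal (λ A → AllP.map⁺ (row-vs-columns a b m n {A})) (boxTilings (suc a) b m (suc n))))

  distinct-columnTails : ∀ a b m n → AllPairs Distinct (columnTails a b (suc m) n)
  distinct-columnTails a b zero    zero    = []
  distinct-columnTails a b zero    (suc n) = distinct a (suc b) 1 (suc n)
  distinct-columnTails a b (suc m) n       = distinct a (suc b) (suc (suc m)) n

  -- Outside the 1 × 1 box the row and the column are different spotlights,
  -- so no row-first tiling is a column-first one.
  row-vs-columns : ∀ a b m n {A} → All (λ B → Distinct (rowSpot a b (suc n) ∷ A) (colSpot a b (suc m) ∷ B))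
                                       (columnTails a b (suc m) n)
  row-vs-columns a b zero zero = []
  row-vs-columns a b zero (suc n) =
    All.map (distinct-heads long-row≉col corner-on-row) (right-avoids-corner a b 0 (suc n))
  row-vs-columns a b (suc m) n =
    All.map (distinct-heads row≉long-col corner-on-row) (right-avoids-corner a b (suc m) n)

same-spot-refl : ∀ {σ} → SameSpot σ σ
same-spot-refl x = mk⇔ (λ p → p) (λ p → p)

same-tiling-refl : ∀ {S} → SameTiling S S
same-tiling-refl = (λ _ τ∈ → Any.map (λ { refl → same-spot-refl }) τ∈)
                 , (λ _ τ∈ → Any.map (λ { refl → same-spot-refl }) τ∈)

cons-same : ∀ {σ σ' A B} → SameSpot σ σ' → SameTiling A B → SameTiling (σ ∷ A) (σ' ∷ B)
cons-same {σ} {σ'} {A} {B} same (A⊑B , B⊑A) = extend same A⊑B , extend (flip same) B⊑A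
  where
  flip : ∀ {τ τ'} → SameSpot τ τ' → SameSpot τ' τ
  flip s x = mk⇔ (Equivalence.from (s x)) (Equivalence.to (s x))
  extend : ∀ {τ τ' X Y} → SameSpot τ τ' → (∀ ρ → ρ ∈ X → Any (SameSpot ρ) Y) →
           ∀ ρ → ρ ∈ τ ∷ X → Any (SameSpot ρ) (τ' ∷ Y)
  extend s matched ρ (here refl) = here s
  extend s matched ρ (there ρ∈) = there (matched ρ ρ∈)

single-square : ∀ {a b} → SameSpot (colSpot a b 1) (rowSpot a b 1)
single-square {a} {b} x = mk⇔ to from
  where
  to : SpotCells (colSpot a b 1) x → SpotCells (rowSpot a b 1) x
  to (zero , _ , refl) = 0 , s≤s z≤n , cong₂ _,_ (+-identityʳ a) (sym (+-identityʳ b))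
  to (suc _ , s≤s () , _)
  from : SpotCells (rowSpot a b 1) x → SpotCells (colSpot a b 1) x
  from (zero , _ , refl) = 0 , s≤s z≤n , cong₂ _,_ (sym (+-identityʳ a)) (+-identityʳ b)
  from (suc _ , s≤s () , _)

-- Its
-- first spotlight is the top row or the left column, and the rest tiles the
-- remaining box, to which the recursion applies.
mutual
  complete : ∀ a b m n {S} → Tiles (Box a b m n) S → Any (SameTiling S) (boxTilings a b m n)
  complete a b zero n t rewrite tiles-of-empty box-no-rows t = here same-tiling-refl
  complete a b (suc m) zero t rewrite tiles-of-empty box-no-cols t = here same-tiling-refl
  complete a b (suc m) (suc n) (empty ne) = ⊥-elim (ne _ box-corner)
  complete a b (suc m) (suc n) (place σ nw max Cs comps Ss tiles) with first-spot {σ = σ} nw max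
  ... | inj₁ refl = AnyP.++⁺ˡ (AnyP.map⁺ (Any.map (cons-same (same-spot-refl {rowSpot a b (suc n)}))
          (complete (suc a) b m (suc n) (remainder-tiling (box-connected _ _ _ _) row-remainder comps tiles))))
  ... | inj₂ refl = column-first a b m n
          (complete a (suc b) (suc m) n (remainder-tiling (box-connected _ _ _ _) col-remainder comps tiles))

  -- A tiling starting with the left column is listed among the column-first
  -- tilings, or, in the 1 × 1 box, as the single row-first tiling.
  column-first : ∀ a b m n {A} → Any (SameTiling A) (boxTilings a (suc b) (suc m) n) →
                 Any (SameTiling (colSpot a b (suc m) ∷ A)) (boxTilings a b (suc m) (suc n))
  column-first a b zero zero (here same) = here (cons-same single-square same)
  column-first a b zero (suc n) found =
    AnyP.++⁺ʳ (map (rowSpot a b (suc (suc n)) ∷_) (boxTilings (suc a) b 0 (suc (suc n))))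
              (AnyP.map⁺ (Any.map (cons-same (same-spot-refl {colSpot a b 1})) found))
  column-first a b (suc m) n found =
    AnyP.++⁺ʳ (map (rowSpot a b (suc n) ∷_) (boxTilings (suc a) b (suc m) (suc n)))
              (AnyP.map⁺ (Any.map (cons-same (same-spot-refl {colSpot a b (2 + m)})) found))

length-split : ∀ a b m n → length (boxTilings a b (suc m) (suc n))
                           ≡ length (boxTilings (suc a) b m (suc n)) + length (columnTails a b (suc m) n)
length-split a b m n =
  trans (length-++ (map (rowSpot a b (suc n) ∷_) (boxTilings (suc a) b m (suc n))))
        (cong₂ _+_ (length-map _ (boxTilings (suc a) b m (suc n))) (length-map _ (columnTails a b (suc m) n)))

open ≡-Reasoning

diagonal : ∀ k → (k + 0) C k ≡ 1
diagonal k rewrite +-identityʳ k = nCn≡1 k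

-- Lengths plus the 1 × 1 defect C(i+j, i) satisfy Pascal's recurrence, so
-- the (suc i) × (suc j) box has C(i+j+2, i+1) - C(i+j, i) tilings.
count : ∀ a b i j → length (boxTilings a b (suc i) (suc j)) + (i + j) C i ≡ (2 + (i + j)) C suc i
count a b zero zero = refl
count a b zero (suc j) = begin
  length (boxTilings a b 1 (suc (suc j))) + 1 ≡⟨ cong (_+ 1) (length-split a b 0 (suc j)) ⟩
  suc (length (boxTilings a (suc b) 1 (suc j)) + 1) ≡⟨ cong suc (count a (suc b) 0 j) ⟩
  suc ((2 + j) C 1)                                ≡⟨ pascal (2 + j) 0 ⟩
  (3 + j) C 1 ∎
count a b (suc i) zero = begin
  length (boxTilings a b (2 + i) 1) + (suc i + 0) C suc i
    ≡⟨ cong₂ _+_ (length-split a b (suc i) 0) (diagonal (suc i)) ⟩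
  (length (boxTilings (suc a) b (suc i) 1) + 1) + 1
    ≡⟨ cong (λ z → (length (boxTilings (suc a) b (suc i) 1) + z) + 1) (sym (diagonal i)) ⟩
  (length (boxTilings (suc a) b (suc i) 1) + (i + 0) C i) + 1
    ≡⟨ cong₂ _+_ (count (suc a) b i zero) (sym (diagonal (2 + i))) ⟩
  X C suc i + X C suc (suc i) ≡⟨ pascal X (suc i) ⟩
  suc X C suc (suc i) ∎
  where X = suc (suc (i + 0))
count a b (suc i) (suc j) = begin
  length (boxTilings a b (2 + i) (2 + j)) + suc X C suc i
                                           ≡⟨ cong (_+ suc X C suc i) (length-split a b (suc i) (suc j)) ⟩
  (below + right) + suc X C suc i          ≡⟨ cong ((below + right) +_) (sym (pascal X i)) ⟩
  (below + right) + (X C i + X C suc i)    ≡⟨ interchange below right (X C i) (X C suc i) ⟩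
  (below + X C i) + (right + X C suc i)    ≡⟨ cong₂ _+_ (count (suc a) b i (suc j))
                                                         (cong (λ z → right + z C suc i) X≡) ⟩
  Y C suc i + (right + (suc i + j) C suc i) ≡⟨ cong (Y C suc i +_) (count a (suc b) (suc i) j) ⟩
  Y C suc i + (2 + (suc i + j)) C (2 + i)  ≡⟨ cong (λ z → Y C suc i + (2 + z) C (2 + i)) (sym X≡) ⟩
  Y C suc i + Y C suc (suc i)              ≡⟨ pascal Y (suc i) ⟩
  suc Y C suc (suc i) ∎
  where
  X = i + suc j
  Y = suc (suc X)
  below = length (boxTilings (suc a) b (suc i) (suc (suc j)))
  right = length (boxTilings a (suc b) (suc (suc i)) (suc j))
  X≡ : X ≡ suc i + j
  X≡ = +-suc i j

count-formula : ∀ a b i j → length (boxTilings a b (suc i) (suc j))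
                            ≡ ((suc i + suc j) C suc i) ∸ ((suc i + suc j ∸ 2) C i)
count-formula a b i j rewrite +-suc i j =
  sym (trans (cong (_∸ ((i + j) C i)) (sym (count a b i j)))
             (m+n∸n≡m (length (boxTilings a b (suc i) (suc j))) ((i + j) C i)))

theorem3p1 : (m n : ℕ) → 1 ≤ m → 1 ≤ n →
    NumTilingsIs m n (((m + n) C m) ∸ ((m + n ∸ 2) C (m ∸ 1)))
theorem3p1 (suc i) (suc j) _ _ =
  boxTilings 0 0 (suc i) (suc j)
  , count-formula 0 0 i j
  , All.map (tiles-resp-≐ (≐-sym (rect≐box (suc i) (suc j)))) (sound 0 0 (suc i) (suc j))
  , distinct 0 0 (suc i) (suc j)
  , λ S t → complete 0 0 (suc i) (suc j) (tiles-resp-≐ (rect≐box (suc i) (suc j)) t)
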